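{- For every $\varepsilon>0$ there exists a family of graph properties $\mathcal{F}(\varepsilon)\subset\mathcal{HPP}^k$ for some $k=O(1/\varepsilon)$, such that $\mathcal{F}(\varepsilon)$ is an $\varepsilon$-cover for induced $P_3$-freeness and $|\mathcal{F}(\varepsilon)|=1$.
   Context: Graphs are finite, simple, undirected with $n$ vertices. For $U,U'\subseteq V$, the cut $(U,U')$ is empty if no $u\in U,u'\in U'$ are adjacent and complete if all $u\in U,u'\in U'$ with $u\neq u'$ are adjacent. A homogeneous $k'$-partition function is a symmetric $\phi:[k']\times[k']\to\{0,1\}$; a graph obeys $\phi$ if its vertex set has a partition $(V_1,\dots,V_{k'})$ (parts may be empty) with $(V_i,V_j)$ empty when $\phi(i,j)=0$ and complete when $\phi(i,j)=1$ (for all $i,j$, including $i=j$). $\mathcal{P}_\phi$ is the set of graphs obeying $\phi$, and $\mathcal{HPP}^k=\{\mathcal{P}_\phi:\phi$ homogeneous $k'$-partition function, $1\le k'\le k\}$. $\Delta(G,G')=(|E\setminus E'|+|E'\setminus E|)/n^2$ and $\Delta(G,\mathcal{Q})=\min_{G'\in\mathcal{Q}}\Delta(G,G')$. A family $\mathcal{F}$ of properties is an $\varepsilon$-cover for a property $\mathcal{P}$ if (1) every $G\in\mathcal{P}$ has $\Delta(G,\mathcal{P}')\le\varepsilon/2$ for some $\mathcal{P}'\in\mathcal{F}$, and (2) every graph in $\bigcup_{\mathcal{P}'\in\mathcal{F}}\mathcal{P}'$ has distance at most $\varepsilon/2$ to $\mathcal{P}$. Induced $P_3$-freeness is the property of having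 no induced subgraph isomorphic to the path on $3$ vertices.
   Formalization: The parameter ε ranges over the positive rationals. -}

module Defs where

open import Level using (Level; suc; 0ℓ)
open import Data.Bool using (Bool; true; false; _∧_; _xor_; if_then_else_)
open import Data.Nat as ℕ using (ℕ; _<ᵇ_)
open import Data.Fin using (Fin; toℕ)
open import Data.List using (List; map; allFin)
open import Data.Nat.ListAction using (sum)
open import Data.List.Relation.Unary.Any using (Any)
open import Data.List.Relation.Unary.All using (All)
open import Data.Integer using (+_)
open import Data.Rational using (ℚ; _/_; _*_; _≤_)
open import Data.Product using (Σ; ∃; _×_)
open import Relation.Binary.PropositionalEquality using (_≡_; _≢_)
open import Relation.Nullary using (¬_)

record Graph (n : ℕ) : Set where
  field
    adj   : Fin n → Fin n → Bool
    sym   : ∀ u v → adj u v ≡ adj v u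
    irrefl : ∀ u → adj u u ≡ false
open Graph public

GraphProperty : Set₁
GraphProperty = ∀ (n : ℕ) → Graph n → Set

-- |E \ E'| + |E' \ E| : number of unordered pairs {u,v} (u < v)
-- that are an edge in exactly one of G, G'.
diffCount : ∀ {n} → Graph n → Graph n → ℕ
diffCount {n} G H =
  sum (map (λ u → sum (map (λ v →
        if (toℕ u <ᵇ toℕ v) ∧ (adj G u v xor adj H u v) then 1 else 0)
      (allFin n))) (allFin n))

ℕtoℚ : ℕ → ℚ
ℕtoℚ m = (+ m) / 1

-- Δ(G,G') ≤ ε/2, where Δ(G,G') = diffCount G G' / n², written without
-- division:  2 · diffCount G G' ≤ ε · n².
DistWithinHalf : ∀ {n} → ℚ → Graph n → Graph n → Set
DistWithinHalf {n} ε G H = ℕtoℚ (2 ℕ.* diffCount G H) ≤ ε * ℕtoℚ (n ℕ.* n)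

-- Δ(G,Q) ≤ ε/2  (min over the nonempty finite set is ≤ ε/2 iff some
-- member of Q on the same vertex set is within ε/2).
DistToPropWithinHalf : ∀ {n} → ℚ → Graph n → GraphProperty → Set
DistToPropWithinHalf {n} ε G Q = ∃ λ (H : Graph n) → Q n H × DistWithinHalf ε G H

IsEpsCover : ℚ → List GraphProperty → GraphProperty → Set₁
IsEpsCover ε F P =
  (∀ n (G : Graph n) → P n G → Any (λ P' → DistToPropWithinHalf ε G P') F)
  × All (λ P' → ∀ n (G : Graph n) → P' n G → DistToPropWithinHalf ε G P) F

record HomPartFun (k' : ℕ) : Set where
  field
    φ     : Fin k' → Fin k' → Bool
    φ-sym : ∀ i j → φ i j ≡ φ j i
open HomPartFun public

-- G obeys φ: there is a partition f : V → [k'] (parts may be empty) such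
-- that every cut (V_i,V_j) is empty if φ i j = 0 and complete if φ i j = 1,
-- i.e. for all distinct u, v : adj u v = φ (f u) (f v).
Obeys : ∀ {k' n} → HomPartFun k' → Graph n → Set
Obeys {k'} {n} Φ G = ∃ λ (f : Fin n → Fin k') →
  ∀ (u v : Fin n) → u ≢ v → adj G u v ≡ φ Φ (f u) (f v)

P[_] : ∀ {k'} → HomPartFun k' → GraphProperty
P[ Φ ] n G = Obeys Φ G

-- P ∈ HPP^k : P = P_φ for some homogeneous k'-partition function, 1 ≤ k' ≤ k.
-- (Equality of properties is taken extensionally: same graphs.)
InHPP : ℕ → GraphProperty → Set
InHPP k P = ∃ λ (k' : ℕ) → (1 ℕ.≤ k') × (k' ℕ.≤ k) × Σ (HomPartFun k') λ Φ →
  ∀ n (G : Graph n) → (P n G → P[ Φ ] n G) × (P[ Φ ] n G → P n G)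

InducedP3Free : GraphProperty
InducedP3Free n G = ¬ (∃ λ a → ∃ λ b → ∃ λ c →
  (a ≢ b) × (b ≢ c) × (a ≢ c) ×
  (adj G a b ≡ true) × (adj G b c ≡ true) × (adj G a c ≡ false))

module Submission where

-- An induced-P₃-free graph is a disjoint union of cliques.  Fix a scale
-- t ≈ 1/ε and K = 2t.  Call a clique (class) large if it has more than n/K
-- vertices; by double counting there are at most K large classes.  Round G to the
-- graph H that keeps the large classes as cliques and deletes all edges inside the
-- small ones.  H obeys the partition function `cliques K` (K clique parts, one
-- independent part, no edges between parts), and every vertex loses fewer than
-- n/K edges, so H is within n²/K = n²/(2t) edits, i.e. within distance ε/2.
-- Conversely every graph obeying `cliques K` is P₃-free.  So the single property
-- P[ cliques K ] ∈ HPP^(2t+1) is an ε-cover, and (2t + 1)·ε ≤ 3(ε + 1).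

open import Defs hiding (sym)
open import Data.Nat as ℕ using (ℕ; zero; suc; z≤n; s≤s)
import Data.Nat.Properties as ℕP
import Data.Nat.Coprimality as Coprimality
open import Data.Integer as ℤ using (+_)
import Data.Integer.Properties as ℤP
open import Data.Rational as ℚ using (ℚ; mkℚ; 0ℚ; 1ℚ; _<_; _≤_; _*_; _+_; ↧ₙ_)
import Data.Rational.Properties as ℚP
open import Data.Rational.Solver using (module +-*-Solver)
import Data.Rational.Unnormalised as ℚᵘ
import Data.Rational.Unnormalised.Properties as ℚᵘP
open import Data.Bool using (Bool; true; false; _∧_; _∨_; _xor_; if_then_else_; not)
open import Data.Bool.Properties using (xor-same; ∨-zeroʳ; T-≡)
open import Data.Fin as Fin using (Fin; zero; suc; toℕ)
import Data.Fin.Properties as FinP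
open import Data.List using (List; length; []; _∷_; map; allFin; tabulate)
import Data.List.Properties as ListP
open import Data.List.Relation.Unary.All using (All; []; _∷_)
open import Data.List.Relation.Unary.Any using (here)
open import Data.Nat.ListAction using () renaming (sum to sumₗ)
open import Algebra.Properties.Semiring.Sum ℕP.+-*-semiring
  using (sum; sum-syntax; sum-cong-≗; ∑-comm; *-distribˡ-sum; *-distribʳ-sum)
open import Data.Product using (∃; _×_; _,_; proj₁; proj₂)
open import Data.Sum using (_⊎_; inj₁; inj₂)
open import Data.Empty using (⊥-elim)
open import Function using (id; _∘_)
open import Function.Bundles using (Equivalence)
open import Relation.Binary using (tri<; tri≈; tri>)
open import Relation.Binary.PropositionalEquality
open import Relation.Nullary using (yes; no; does)
open import Relation.Nullary.Decidable using (dec-true)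

[_/1] : ℕ → ℚ
[ m /1] = mkℚ (+ m) 0 (Coprimality.sym (Coprimality.1-coprimeTo m))

ℕtoℚ-normal : ∀ m → ℕtoℚ m ≡ [ m /1]
ℕtoℚ-normal m = ℚP.↥p/↧p≡p [ m /1]

ℕtoℚ-+ : ∀ a b → ℕtoℚ (a ℕ.+ b) ≡ ℕtoℚ a + ℕtoℚ b
ℕtoℚ-+ a b rewrite ℕtoℚ-normal (a ℕ.+ b) | ℕtoℚ-normal a | ℕtoℚ-normal b =
  ℚP.toℚᵘ-injective (ℚᵘP.≃-trans (ℚᵘ.*≡* numerators) (ℚᵘP.≃-sym (ℚP.toℚᵘ-homo-+ [ a /1] [ b /1])))
  where
  numerators : + (a ℕ.+ b) ℤ.* + 1 ≡ (+ a ℤ.* + 1 ℤ.+ + b ℤ.* + 1) ℤ.* + 1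
  numerators = cong (ℤ._* + 1) (trans (ℤP.pos-+ a b)
    (sym (cong₂ ℤ._+_ (ℤP.*-identityʳ (+ a)) (ℤP.*-identityʳ (+ b)))))

ℕtoℚ-* : ∀ a b → ℕtoℚ (a ℕ.* b) ≡ ℕtoℚ a * ℕtoℚ b
ℕtoℚ-* a b rewrite ℕtoℚ-normal (a ℕ.* b) | ℕtoℚ-normal a | ℕtoℚ-normal b =
  ℚP.toℚᵘ-injective (ℚᵘP.≃-trans (ℚᵘ.*≡* numerators) (ℚᵘP.≃-sym (ℚP.toℚᵘ-homo-* [ a /1] [ b /1])))
  where
  numerators : + (a ℕ.* b) ℤ.* + 1 ≡ (+ a ℤ.* + b) ℤ.* + 1
  numerators = cong (ℤ._* + 1) (ℤP.pos-* a b)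

ℕtoℚ-mono : ∀ {a b} → a ℕ.≤ b → ℕtoℚ a ≤ ℕtoℚ b
ℕtoℚ-mono {a} {b} a≤b rewrite ℕtoℚ-normal a | ℕtoℚ-normal b =
  ℚ.*≤* (subst₂ ℤ._≤_ (sym (ℤP.*-identityʳ (+ a))) (sym (ℤP.*-identityʳ (+ b))) (ℤ.+≤+ a≤b))

ℕtoℚ-nonNeg : ∀ a → 0ℚ ≤ ℕtoℚ a
ℕtoℚ-nonNeg a = ℕtoℚ-mono {0} {a} z≤n

-- Multiplying a positive rational by its denominator yields its numerator, which is at least 1.
denominator-clears : ∀ ε → 0ℚ < ε → 1ℚ ≤ ℕtoℚ (↧ₙ ε) * ε
denominator-clears ε@(mkℚ ℤ.+[1+ p ] d _) _ rewrite ℕtoℚ-normal (suc d) =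
  ℚP.toℚᵘ-cancel-≤ (ℚᵘP.≤-respʳ-≃ (ℚᵘP.≃-sym (ℚP.toℚᵘ-homo-* [ suc d /1] ε)) (ℚᵘ.*≤* cross))
  where
  cross : + 1 ℤ.* + (1 ℕ.* suc d) ℤ.≤ (+ suc d ℤ.* + suc p) ℤ.* + 1
  cross = subst₂ ℤ._≤_
    (sym (trans (ℤP.*-identityˡ _) (cong +_ (ℕP.*-identityˡ (suc d)))))
    (trans (ℤP.pos-* (suc d) (suc p)) (sym (ℤP.*-identityʳ _)))
    (ℤ.+≤+ (ℕP.m≤m*n (suc d) (suc p)))
denominator-clears (mkℚ (+ 0) _ _) (ℚ.*<* (ℤ.+<+ ()))
denominator-clears (mkℚ ℤ.-[1+ _ ] _ _) (ℚ.*<* ())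

-- Archimedean step: if some multiple m·ε reaches 1, then the least such multiple
-- t·ε overshoots 1 by at most ε.
least-multiple-above-one : ∀ ε m → 1ℚ ≤ ℕtoℚ m * ε →
  ∃ λ t → (1ℚ ≤ ℕtoℚ t * ε) × (ℕtoℚ t * ε ≤ 1ℚ + ε)
least-multiple-above-one ε zero 1≤0 with ℚP.≤-trans 1≤0 (ℚP.≤-reflexive (ℚP.*-zeroˡ ε))
... | ℚ.*≤* (ℤ.+≤+ ())
least-multiple-above-one ε (suc m) 1≤[m+1]ε with 1ℚ ℚP.≤? ℕtoℚ m * ε
... | yes 1≤mε = least-multiple-above-one ε m 1≤mε
... | no 1≰mε = suc m , 1≤[m+1]ε , overshoot
  where
  open ℚP.≤-Reasoning
  overshoot : ℕtoℚ (suc m) * ε ≤ 1ℚ + ε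
  overshoot = begin
    ℕtoℚ (1 ℕ.+ m) * ε          ≡⟨ cong (_* ε) (ℕtoℚ-+ 1 m) ⟩
    (1ℚ + ℕtoℚ m) * ε          ≡⟨ ℚP.*-distribʳ-+ ε 1ℚ (ℕtoℚ m) ⟩
    1ℚ * ε + ℕtoℚ m * ε        ≤⟨ ℚP.+-monoʳ-≤ (1ℚ * ε) (ℚP.<⇒≤ (ℚP.≰⇒> 1≰mε)) ⟩
    1ℚ * ε + 1ℚ                ≡⟨ cong (_+ 1ℚ) (ℚP.*-identityˡ ε) ⟩
    ε + 1ℚ                     ≡⟨ ℚP.+-comm ε 1ℚ ⟩
    1ℚ + ε                     ∎

scale-for : ∀ ε → 0ℚ < ε → ∃ λ t → (1ℚ ≤ ℕtoℚ t * ε) × (ℕtoℚ t * ε ≤ 1ℚ + ε)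
scale-for ε ε>0 = least-multiple-above-one ε (↧ₙ ε) (denominator-clears ε ε>0)

count-within-half : ∀ ε t D n → 0ℚ ≤ ε → 1ℚ ≤ ℕtoℚ t * ε →
  (2 ℕ.* t) ℕ.* D ℕ.≤ n ℕ.* n → ℕtoℚ (2 ℕ.* D) ≤ ε * ℕtoℚ (n ℕ.* n)
count-within-half ε t D n ε≥0 tε≥1 count≤n² = begin
  a                        ≡⟨ ℚP.*-identityʳ a ⟨
  a * 1ℚ                   ≤⟨ ℚP.*-monoˡ-≤-nonNeg a {{ℚ.nonNegative (ℕtoℚ-nonNeg (2 ℕ.* D))}} tε≥1 ⟩
  a * (ℕtoℚ t * ε)         ≡⟨ ℚP.*-assoc a (ℕtoℚ t) ε ⟨
  (a * ℕtoℚ t) * ε         ≡⟨ cong (_* ε) (ℕtoℚ-* (2 ℕ.* D) t) ⟨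
  ℕtoℚ (2 ℕ.* D ℕ.* t) * ε ≡⟨ cong (λ m → ℕtoℚ m * ε) (rearrange D t) ⟩
  ℕtoℚ (2 ℕ.* t ℕ.* D) * ε ≤⟨ ℚP.*-monoʳ-≤-nonNeg ε {{ℚ.nonNegative ε≥0}} (ℕtoℚ-mono count≤n²) ⟩
  ℕtoℚ (n ℕ.* n) * ε       ≡⟨ ℚP.*-comm _ ε ⟩
  ε * ℕtoℚ (n ℕ.* n)       ∎
  where
  open ℚP.≤-Reasoning
  a : ℚ
  a = ℕtoℚ (2 ℕ.* D)
  rearrange : ∀ D t → 2 ℕ.* D ℕ.* t ≡ 2 ℕ.* t ℕ.* D
  rearrange D t = trans (ℕP.*-assoc 2 D t) (trans (cong (2 ℕ.*_) (ℕP.*-comm D t)) (sym (ℕP.*-assoc 2 t D)))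

nothing-within-half : ∀ ε m → 0ℚ ≤ ε → ℕtoℚ 0 ≤ ε * ℕtoℚ m
nothing-within-half ε m ε≥0 = ℚP.nonNegative⁻¹ (ε * ℕtoℚ m)
  {{ℚP.nonNeg*nonNeg⇒nonNeg ε {{ℚ.nonNegative ε≥0}} (ℕtoℚ m) {{ℚ.nonNegative (ℕtoℚ-nonNeg m)}}}}

parts-bound : ∀ ε t → 0ℚ ≤ ε → ℕtoℚ t * ε ≤ 1ℚ + ε →
  ℕtoℚ (suc (2 ℕ.* t)) * ε ≤ ℕtoℚ 3 * (ε + 1ℚ)
parts-bound ε t ε≥0 tε≤1+ε = begin
  ℕtoℚ (1 ℕ.+ 2 ℕ.* t) * ε      ≡⟨ cong (_* ε) (trans (ℕtoℚ-+ 1 (2 ℕ.* t)) (cong (λ q → 1ℚ + q) (ℕtoℚ-* 2 t))) ⟩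
  (1ℚ + two * ℕtoℚ t) * ε       ≡⟨ expand (ℕtoℚ t) ε ⟩
  ε + two * (ℕtoℚ t * ε)        ≤⟨ ℚP.+-mono-≤ ε≤y (ℚP.*-monoˡ-≤-nonNeg two (ℚP.≤-trans tε≤1+ε (ℚP.≤-reflexive (ℚP.+-comm 1ℚ ε)))) ⟩
  y + two * y                   ≡⟨ collect y ⟩
  ℕtoℚ 3 * y                    ∎
  where
  open ℚP.≤-Reasoning
  open +-*-Solver
  two : ℚ
  two = ℕtoℚ 2
  y : ℚ
  y = ε + 1ℚ
  ε≤y : ε ≤ y
  ε≤y = ℚP.≤-trans (ℚP.≤-reflexive (sym (ℚP.+-identityʳ ε))) (ℚP.+-monoʳ-≤ ε (ℕtoℚ-nonNeg 1))
  expand : ∀ T e → (1ℚ + two * T) * e ≡ e + two * (T * e)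
  expand = solve 2 (λ T e → (con 1ℚ :+ con two :* T) :* e := e :+ con two :* (T :* e)) refl
  collect : ∀ y → y + two * y ≡ ℕtoℚ 3 * y
  collect = solve 1 (λ y → y :+ con two :* y := con (ℕtoℚ 3) :* y) refl

sum-mono : ∀ {n} {f g : Fin n → ℕ} → (∀ i → f i ℕ.≤ g i) → sum f ℕ.≤ sum g
sum-mono {zero}  f≤g = z≤n
sum-mono {suc n} f≤g = ℕP.+-mono-≤ (f≤g zero) (sum-mono (f≤g ∘ suc))

sum-mono-< : ∀ {n} {f g : Fin n → ℕ} → (∀ i → f i ℕ.≤ g i) → ∀ j → f j ℕ.< g j → sum f ℕ.< sum g
sum-mono-< {suc n} f≤g zero    fj<gj = ℕP.+-mono-<-≤ fj<gj (sum-mono (f≤g ∘ suc))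
sum-mono-< {suc n} f≤g (suc j) fj<gj = ℕP.+-mono-≤-< (f≤g zero) (sum-mono-< (f≤g ∘ suc) j fj<gj)

sum-const : ∀ n c → ∑[ i < n ] c ≡ n ℕ.* c
sum-const zero    c = refl
sum-const (suc n) c = cong (c ℕ.+_) (sum-const n c)

sumₗ-allFin : ∀ n (g : Fin n → ℕ) → sumₗ (map g (allFin n)) ≡ sum g
sumₗ-allFin n g = trans (cong sumₗ (ListP.map-tabulate id g)) (sum-tabulate g)
  where
  sum-tabulate : ∀ {m} (h : Fin m → ℕ) → sumₗ (tabulate h) ≡ sum h
  sum-tabulate {zero}  h = refl
  sum-tabulate {suc m} h = cong (h zero ℕ.+_) (sum-tabulate (h ∘ suc))

ind : Bool → ℕ
ind b = if b then 1 else 0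

ind≤1 : ∀ b → ind b ℕ.≤ 1
ind≤1 true  = ℕP.≤-refl
ind≤1 false = z≤n

ind-∧ʳ : ∀ a b → ind (a ∧ b) ℕ.≤ ind b
ind-∧ʳ true  b = ℕP.≤-refl
ind-∧ʳ false b = z≤n

count-≡ : ∀ {n} (a : Fin n) → ∑[ i < n ] ind (does (i Fin.≟ a)) ≡ 1
count-≡ {suc n} zero    = cong suc (trans (sum-const n 0) (ℕP.*-zeroʳ n))
count-≡ {suc n} (suc a) = count-≡ a

true≢false : true ≢ false
true≢false ()

adj⇒≢ : ∀ {n} (G : Graph n) {u v} → adj G u v ≡ true → u ≢ v
adj⇒≢ G {u} uv refl = true≢false (trans (sym uv) (irrefl G u))

<⇒<ᵇ≡true : ∀ {m n} → m ℕ.< n → (m ℕ.<ᵇ n) ≡ true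
<⇒<ᵇ≡true m<n = Equivalence.to T-≡ (ℕP.<⇒<ᵇ m<n)

<ᵇ≡true⇒< : ∀ m n → (m ℕ.<ᵇ n) ≡ true → m ℕ.< n
<ᵇ≡true⇒< m n m<ᵇn = ℕP.<ᵇ⇒< m n (Equivalence.from T-≡ m<ᵇn)

<ᵇ-irrefl : ∀ m → (m ℕ.<ᵇ m) ≡ false
<ᵇ-irrefl m with m ℕ.<ᵇ m in m<ᵇm
... | true  = ⊥-elim (ℕP.<-irrefl refl (<ᵇ≡true⇒< m m m<ᵇm))
... | false = refl

mismatches : ∀ {n} → Graph n → Graph n → Fin n → ℕ
mismatches {n} G H u = ∑[ v < n ] ind (adj G u v xor adj H u v)

-- diffCount counts each mismatching unordered pair once, hence is at most the
-- sum of the mismatch degrees.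
diffCount≤mismatches : ∀ {n} (G H : Graph n) → diffCount G H ℕ.≤ ∑[ u < n ] mismatches G H u
diffCount≤mismatches {n} G H = begin
  diffCount G H
    ≡⟨ trans (sumₗ-allFin n _) (sum-cong-≗ {n} (λ u → sumₗ-allFin n _)) ⟩
  ∑[ u < n ] ∑[ v < n ] ind ((toℕ u ℕ.<ᵇ toℕ v) ∧ (adj G u v xor adj H u v))
    ≤⟨ sum-mono {n} (λ u → sum-mono {n} (λ v → ind-∧ʳ (toℕ u ℕ.<ᵇ toℕ v) _)) ⟩
  ∑[ u < n ] mismatches G H u ∎
  where open ℕP.≤-Reasoning

edit-bound : ∀ {n} (G H : Graph n) K → (∀ u → K ℕ.* mismatches G H u ℕ.≤ n) →
  K ℕ.* diffCount G H ℕ.≤ n ℕ.* n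
edit-bound {n} G H K few = begin
  K ℕ.* diffCount G H                   ≤⟨ ℕP.*-monoʳ-≤ K (diffCount≤mismatches G H) ⟩
  K ℕ.* (∑[ u < n ] mismatches G H u)   ≡⟨ *-distribˡ-sum K (mismatches G H) ⟩
  ∑[ u < n ] (K ℕ.* mismatches G H u)  ≤⟨ sum-mono few ⟩
  ∑[ u < n ] n                          ≡⟨ sum-const n n ⟩
  n ℕ.* n                               ∎
  where open ℕP.≤-Reasoning

diffCount-self : ∀ {n} (H : Graph n) → diffCount H H ≡ 0
diffCount-self {n} H = ℕP.n≤0⇒n≡0 (begin
  diffCount H H                    ≤⟨ diffCount≤mismatches H H ⟩
  ∑[ u < n ] mismatches H H u      ≡⟨ sum-cong-≗ {n} (λ u → sum-cong-≗ {n} (λ v → cong ind (xor-same (adj H u v)))) ⟩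
  ∑[ u < n ] ∑[ v < n ] 0          ≡⟨ sum-cong-≗ {n} (λ u → sum-const n 0) ⟩
  ∑[ u < n ] (n ℕ.* 0)             ≡⟨ sum-const n (n ℕ.* 0) ⟩
  n ℕ.* (n ℕ.* 0)                  ≡⟨ cong (n ℕ.*_) (ℕP.*-zeroʳ n) ⟩
  n ℕ.* 0                          ≡⟨ ℕP.*-zeroʳ n ⟩
  0                                ∎)
  where open ℕP.≤-Reasoning

partition-in-HPP : ∀ {k'} (Φ : HomPartFun k') → 1 ℕ.≤ k' → InHPP k' P[ Φ ]
partition-in-HPP {k'} Φ k'≥1 = k' , k'≥1 , ℕP.≤-refl , Φ , λ n G → id , id

realise : ∀ {k' n} → HomPartFun k' → (Fin n → Fin k') → Graph n
realise {n = n} Φ f = record { adj = edge ; sym = edge-sym ; irrefl = edge-irrefl }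
  where
  edge : Fin n → Fin n → Bool
  edge u v = if does (u Fin.≟ v) then false else φ Φ (f u) (f v)
  edge-sym : ∀ u v → edge u v ≡ edge v u
  edge-sym u v with u Fin.≟ v | v Fin.≟ u
  ... | yes _    | yes _    = refl
  ... | no _     | no _     = φ-sym Φ (f u) (f v)
  ... | yes refl | no v≢u   = ⊥-elim (v≢u refl)
  ... | no u≢v   | yes refl = ⊥-elim (u≢v refl)
  edge-irrefl : ∀ u → edge u u ≡ false
  edge-irrefl u with u Fin.≟ u
  ... | yes _   = refl
  ... | no u≢u  = ⊥-elim (u≢u refl)

realise-obeys : ∀ {k' n} (Φ : HomPartFun k') (f : Fin n → Fin k') → Obeys Φ (realise Φ f)
realise-obeys Φ f = f , edges
  where
  edges : ∀ u v → u ≢ v → adj (realise Φ f) u v ≡ φ Φ (f u) (f v)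
  edges u v u≢v with u Fin.≟ v
  ... | yes u≡v = ⊥-elim (u≢v u≡v)
  ... | no _    = refl

-- If Φ has edges only inside parts (φ i j = 1 forces i = j), every graph obeying Φ
-- is a disjoint union of cliques and hence induced-P₃-free.
diagonal-obeys⇒P3-free : ∀ {k' n} (Φ : HomPartFun k') → (∀ i j → φ Φ i j ≡ true → i ≡ j) →
  (G : Graph n) → Obeys Φ G → InducedP3Free n G
diagonal-obeys⇒P3-free Φ diagonal G (f , edges) (a , b , c , a≢b , b≢c , a≢c , ab , bc , ac) =
  true≢false (begin
    true               ≡⟨ ab ⟨
    adj G a b          ≡⟨ edges a b a≢b ⟩
    φ Φ (f a) (f b)    ≡⟨ cong (φ Φ (f a)) fb≡fc ⟩
    φ Φ (f a) (f c)    ≡⟨ edges a c a≢c ⟨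
    adj G a c          ≡⟨ ac ⟩
    false              ∎)
  where
  open ≡-Reasoning
  fb≡fc : f b ≡ f c
  fb≡fc = diagonal (f b) (f c) (trans (sym (edges b c b≢c)) bc)

clique-or-isolated : ∀ K → Fin (suc K) → Fin (suc K) → Bool
clique-or-isolated K i j = does (i Fin.≟ j) ∧ (toℕ i ℕ.<ᵇ K)

cliques : ∀ K → HomPartFun (suc K)
cliques K = record { φ = clique-or-isolated K ; φ-sym = symmetric }
  where
  symmetric : ∀ i j → clique-or-isolated K i j ≡ clique-or-isolated K j i
  symmetric i j with i Fin.≟ j | j Fin.≟ i
  ... | yes refl | yes _    = refl
  ... | no _     | no _     = refl
  ... | yes refl | no i≢i   = ⊥-elim (i≢i refl)
  ... | no i≢j   | yes refl = ⊥-elim (i≢j refl)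

cliques-edge : ∀ K i j → clique-or-isolated K i j ≡ true → i ≡ j × toℕ i ℕ.< K
cliques-edge K i j e with i Fin.≟ j
... | yes i≡j = i≡j , <ᵇ≡true⇒< (toℕ i) K e

cliques-loop : ∀ K i → toℕ i ℕ.< K → clique-or-isolated K i i ≡ true
cliques-loop K i i<K with i Fin.≟ i
... | yes _   = <⇒<ᵇ≡true i<K
... | no i≢i  = ⊥-elim (i≢i refl)

minimum : ∀ {n} (p : Fin n → Bool) j → p j ≡ true →
  ∃ λ i → p i ≡ true × (∀ k → p k ≡ true → i Fin.≤ k)
minimum {suc n} p j pj with p zero in p0
... | true = zero , p0 , λ _ _ → z≤n
minimum {suc n} p zero    pj | false with trans (sym p0) pj
... | ()
minimum {suc n} p (suc j) pj | false with minimum (p ∘ suc) j pj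
... | i , pi , least = suc i , pi , least′
  where
  least′ : ∀ k → p k ≡ true → suc i Fin.≤ k
  least′ zero    pk with trans (sym p0) pk
  ... | ()
  least′ (suc k) pk = s≤s (least k pk)

-- An induced-P₃-free graph is a disjoint union of cliques: "u = v or u ~ v" is an
-- equivalence relation whose classes are the cliques.  Each class has a
-- representative, its least vertex.
module CliqueClasses {n} (G : Graph n) (p3-free : InducedP3Free n G) where

  Same : Fin n → Fin n → Bool
  Same u v = does (u Fin.≟ v) ∨ adj G u v

  Same-refl : ∀ u → Same u u ≡ true
  Same-refl u with u Fin.≟ u
  ... | yes _   = refl
  ... | no u≢u  = ⊥-elim (u≢u refl)

  Same-cases : ∀ u v → Same u v ≡ true → u ≡ v ⊎ adj G u v ≡ true
  Same-cases u v same with u Fin.≟ v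
  ... | yes u≡v = inj₁ u≡v
  ... | no _    = inj₂ same

  adj⇒Same : ∀ u v → adj G u v ≡ true → Same u v ≡ true
  adj⇒Same u v uv with u Fin.≟ v
  ... | yes _ = refl
  ... | no _  = uv

  Same-sym : ∀ u v → Same u v ≡ true → Same v u ≡ true
  Same-sym u v same with Same-cases u v same
  ... | inj₁ refl = Same-refl u
  ... | inj₂ uv   = adj⇒Same v u (trans (Graph.sym G v u) uv)

  -- Transitivity is exactly induced-P₃-freeness: u ~ v ~ w with u ≠ w forces u ~ w.
  Same-trans : ∀ u v w → Same u v ≡ true → Same v w ≡ true → Same u w ≡ true
  Same-trans u v w uv vw with Same-cases u v uv | Same-cases v w vw
  ... | inj₁ refl | _         = vw
  ... | inj₂ _    | inj₁ refl = uv
  ... | inj₂ u~v  | inj₂ v~w with u Fin.≟ w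
  ...   | yes _   = refl
  ...   | no u≢w with adj G u w in u~w
  ...     | true  = refl
  ...     | false = ⊥-elim (p3-free (u , v , w , adj⇒≢ G u~v , adj⇒≢ G v~w , u≢w , u~v , v~w , u~w))

  Same-class : ∀ u v → Same u v ≡ true → ∀ w → Same u w ≡ Same v w
  Same-class u v uv w with Same u w in uw | Same v w in vw
  ... | true  | true  = refl
  ... | false | false = refl
  ... | true  | false = trans (sym (Same-trans v u w (Same-sym u v uv) uw)) vw
  ... | false | true  = trans (sym uw) (Same-trans u v w uv vw)

  classSize : Fin n → ℕ
  classSize u = ∑[ v < n ] ind (Same u v)

  classSize-cong : ∀ u v → Same u v ≡ true → classSize u ≡ classSize v
  classSize-cong u v uv = sum-cong-≗ {n} (λ w → cong ind (Same-class u v uv w))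

  private
    least-of-class : ∀ u → ∃ λ r → Same u r ≡ true × (∀ k → Same u k ≡ true → r Fin.≤ k)
    least-of-class u = minimum (Same u) u (Same-refl u)

  rep : Fin n → Fin n
  rep u = proj₁ (least-of-class u)

  rep-Same : ∀ u → Same u (rep u) ≡ true
  rep-Same u = proj₁ (proj₂ (least-of-class u))

  rep-cong : ∀ u v → Same u v ≡ true → rep u ≡ rep v
  rep-cong u v uv = FinP.≤-antisym
    (proj₂ (proj₂ (least-of-class u)) (rep v) (Same-trans u v (rep v) uv (rep-Same v)))
    (proj₂ (proj₂ (least-of-class v)) (rep u) (Same-trans v u (rep u) (Same-sym u v uv) (rep-Same u)))

  rep-idem : ∀ u → rep (rep u) ≡ rep u
  rep-idem u = sym (rep-cong u (rep u) (rep-Same u))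

  rep-injective : ∀ u v → rep u ≡ rep v → Same u v ≡ true
  rep-injective u v ru≡rv =
    Same-trans u (rep v) v (subst (λ r → Same u r ≡ true) ru≡rv (rep-Same u)) (Same-sym v (rep v) (rep-Same v))

-- Rounding a P₃-free graph G to a graph H obeying `cliques K`: each large class
-- (more than n/K vertices) becomes its own clique part, numbered by the rank of its
-- representative among the large representatives; every other vertex goes to the
-- independent part K.  H differs from G only by deleting the edges inside small
-- classes, and a vertex of a small class loses fewer than n/K edges.
module Rounding {n} (G : Graph n) (p3-free : InducedP3Free n G) (K : ℕ) where
  open CliqueClasses G p3-free

  large : Fin n → Bool
  large u = n ℕ.<ᵇ K ℕ.* classSize u

  large-cong : ∀ u v → Same u v ≡ true → large u ≡ large v
  large-cong u v uv = cong (λ s → n ℕ.<ᵇ K ℕ.* s) (classSize-cong u v uv)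

  largeRep : Fin n → Bool
  largeRep r = does (rep r Fin.≟ r) ∧ large r

  largeRep⇒rep : ∀ r → largeRep r ≡ true → rep r ≡ r
  largeRep⇒rep r lr with rep r Fin.≟ r | lr
  ... | yes rr≡r | _ = rr≡r
  ... | no _     | ()

  largeRep⇒large : ∀ r → largeRep r ≡ true → large r ≡ true
  largeRep⇒large r lr with does (rep r Fin.≟ r) | lr
  ... | true  | lr′ = lr′
  ... | false | ()

  largeRep-rep : ∀ u → large u ≡ true → largeRep (rep u) ≡ true
  largeRep-rep u lu with rep (rep u) Fin.≟ rep u
  ... | yes _   = trans (sym (large-cong u (rep u) (rep-Same u))) lu
  ... | no rr≢r = ⊥-elim (rr≢r (rep-idem u))

  numLarge : ℕ
  numLarge = ∑[ r < n ] ind (largeRep r)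

  large-class-size : ∀ r → ind (largeRep r) ℕ.* n ℕ.≤ K ℕ.* ∑[ v < n ] ind (largeRep r ∧ Same r v)
  large-class-size r with largeRep r in lr
  ... | false = z≤n
  ... | true  = subst (ℕ._≤ K ℕ.* classSize r) (sym (ℕP.+-identityʳ n))
    (ℕP.<⇒≤ (<ᵇ≡true⇒< n (K ℕ.* classSize r) (largeRep⇒large r lr)))

  one-large-rep : ∀ v → ∑[ r < n ] ind (largeRep r ∧ Same r v) ℕ.≤ 1
  one-large-rep v = ℕP.≤-trans (sum-mono {n} only-rep) (ℕP.≤-reflexive (count-≡ (rep v)))
    where
    only-rep : ∀ r → ind (largeRep r ∧ Same r v) ℕ.≤ ind (does (r Fin.≟ rep v))
    only-rep r with largeRep r in lr | Same r v in rv
    ... | false | _     = z≤n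
    ... | true  | false = z≤n
    ... | true  | true  = ℕP.≤-reflexive (sym (cong ind
          (dec-true (r Fin.≟ rep v) (trans (sym (largeRep⇒rep r lr)) (rep-cong r v rv)))))

  numLarge≤K : Fin n → numLarge ℕ.≤ K
  numLarge≤K u = ℕP.*-cancelʳ-≤ numLarge K n {{nonZero u}} (begin
    numLarge ℕ.* n                                                  ≡⟨ *-distribʳ-sum n (ind ∘ largeRep) ⟩
    ∑[ r < n ] (ind (largeRep r) ℕ.* n)                             ≤⟨ sum-mono {n} large-class-size ⟩
    ∑[ r < n ] (K ℕ.* ∑[ v < n ] ind (largeRep r ∧ Same r v))       ≡⟨ *-distribˡ-sum {n} K _ ⟨
    K ℕ.* ∑[ r < n ] ∑[ v < n ] ind (largeRep r ∧ Same r v)         ≡⟨ cong (K ℕ.*_) (∑-comm {n} {n} _) ⟩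
    K ℕ.* ∑[ v < n ] ∑[ r < n ] ind (largeRep r ∧ Same r v)         ≤⟨ ℕP.*-monoʳ-≤ K (sum-mono {n} one-large-rep) ⟩
    K ℕ.* ∑[ v < n ] 1                                              ≡⟨ cong (K ℕ.*_) (trans (sum-const n 1) (ℕP.*-identityʳ n)) ⟩
    K ℕ.* n                                                         ∎)
    where
    open ℕP.≤-Reasoning
    nonZero : ∀ {m} → Fin m → ℕ.NonZero m
    nonZero {suc m} _ = _

  -- The number of large representatives preceding r: it numbers the large classes injectively.
  rank : Fin n → ℕ
  rank r = ∑[ v < n ] ind ((toℕ v ℕ.<ᵇ toℕ r) ∧ largeRep v)

  rank<numLarge : ∀ r → largeRep r ≡ true → rank r ℕ.< numLarge
  rank<numLarge r lr = sum-mono-< {n} (λ v → ind-∧ʳ (toℕ v ℕ.<ᵇ toℕ r) (largeRep v)) r r-not-before-r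
    where
    r-not-before-r : ind ((toℕ r ℕ.<ᵇ toℕ r) ∧ largeRep r) ℕ.< ind (largeRep r)
    r-not-before-r rewrite <ᵇ-irrefl (toℕ r) | lr = s≤s z≤n

  rank-strict : ∀ r₁ r₂ → r₁ Fin.< r₂ → largeRep r₁ ≡ true → rank r₁ ℕ.< rank r₂
  rank-strict r₁ r₂ r₁<r₂ lr₁ = sum-mono-< {n} before-r₁⇒before-r₂ r₁ r₁-before-r₂
    where
    before-r₁⇒before-r₂ : ∀ v → ind ((toℕ v ℕ.<ᵇ toℕ r₁) ∧ largeRep v) ℕ.≤ ind ((toℕ v ℕ.<ᵇ toℕ r₂) ∧ largeRep v)
    before-r₁⇒before-r₂ v with toℕ v ℕ.<ᵇ toℕ r₁ in v<r₁
    ... | false = z≤n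
    ... | true rewrite <⇒<ᵇ≡true (ℕP.<-trans (<ᵇ≡true⇒< (toℕ v) (toℕ r₁) v<r₁) r₁<r₂) = ℕP.≤-refl
    r₁-before-r₂ : ind ((toℕ r₁ ℕ.<ᵇ toℕ r₁) ∧ largeRep r₁) ℕ.< ind ((toℕ r₁ ℕ.<ᵇ toℕ r₂) ∧ largeRep r₁)
    r₁-before-r₂ rewrite <ᵇ-irrefl (toℕ r₁) | <⇒<ᵇ≡true r₁<r₂ | lr₁ = s≤s z≤n

  rank-injective : ∀ r₁ r₂ → largeRep r₁ ≡ true → largeRep r₂ ≡ true → rank r₁ ≡ rank r₂ → r₁ ≡ r₂
  rank-injective r₁ r₂ lr₁ lr₂ same-rank with FinP.<-cmp r₁ r₂
  ... | tri< r₁<r₂ _ _ = ⊥-elim (ℕP.<-irrefl same-rank (rank-strict r₁ r₂ r₁<r₂ lr₁))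
  ... | tri≈ _ r₁≡r₂ _ = r₁≡r₂
  ... | tri> _ _ r₂<r₁ = ⊥-elim (ℕP.<-irrefl (sym same-rank) (rank-strict r₂ r₁ r₂<r₁ lr₂))

  code : Fin n → ℕ
  code u = if large u then rank (rep u) else K

  code-large : ∀ u → large u ≡ true → code u ≡ rank (rep u)
  code-large u lu = cong (λ b → if b then rank (rep u) else K) lu

  large⇒code<K : ∀ u → large u ≡ true → code u ℕ.< K
  large⇒code<K u lu = subst (ℕ._< K) (sym (code-large u lu))
    (ℕP.<-≤-trans (rank<numLarge (rep u) (largeRep-rep u lu)) (numLarge≤K u))

  code<K⇒large : ∀ u → code u ℕ.< K → large u ≡ true
  code<K⇒large u code<K with large u
  ... | true  = refl
  ... | false = ⊥-elim (ℕP.<-irrefl refl code<K)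

  code≤K : ∀ u → code u ℕ.≤ K
  code≤K u with large u in lu
  ... | true  = ℕP.<⇒≤ (subst (ℕ._< K) (code-large u lu) (large⇒code<K u lu))
  ... | false = ℕP.≤-refl

  part : Fin n → Fin (suc K)
  part u = Fin.fromℕ< (s≤s (code≤K u))

  toℕ-part : ∀ u → toℕ (part u) ≡ code u
  toℕ-part u = FinP.toℕ-fromℕ< (s≤s (code≤K u))

  H : Graph n
  H = realise (cliques K) part

  H-adj : ∀ u v → u ≢ v → adj H u v ≡ clique-or-isolated K (part u) (part v)
  H-adj = proj₂ (realise-obeys (cliques K) part)

  H-edge : ∀ u v → adj H u v ≡ true → large u ≡ true × rep u ≡ rep v
  H-edge u v uv = lu , rank-injective (rep u) (rep v) (largeRep-rep u lu) (largeRep-rep v lv) same-rank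
    where
    same-part : part u ≡ part v × toℕ (part u) ℕ.< K
    same-part = cliques-edge K (part u) (part v) (trans (sym (H-adj u v (adj⇒≢ H uv))) uv)
    same-code : code u ≡ code v
    same-code = trans (sym (toℕ-part u)) (trans (cong toℕ (proj₁ same-part)) (toℕ-part v))
    lu : large u ≡ true
    lu = code<K⇒large u (subst (ℕ._< K) (toℕ-part u) (proj₂ same-part))
    lv : large v ≡ true
    lv = code<K⇒large v (subst (ℕ._< K) (trans (toℕ-part u) same-code) (proj₂ same-part))
    same-rank : rank (rep u) ≡ rank (rep v)
    same-rank = trans (sym (code-large u lu)) (trans same-code (code-large v lv))

  H-no-new-edges : ∀ u v → adj G u v ≡ false → adj H u v ≡ false
  H-no-new-edges u v u≁v with adj H u v in uv
  ... | false = refl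
  ... | true with Same-cases u v (rep-injective u v (proj₂ (H-edge u v uv)))
  ...   | inj₁ u≡v = ⊥-elim (adj⇒≢ H uv u≡v)
  ...   | inj₂ u~v with trans (sym u≁v) u~v
  ...     | ()

  H-keeps-large : ∀ u v → large u ≡ true → adj G u v ≡ true → adj H u v ≡ true
  H-keeps-large u v lu uv = begin
    adj H u v                                          ≡⟨ H-adj u v (adj⇒≢ G uv) ⟩
    clique-or-isolated K (part u) (part v)             ≡⟨ cong (clique-or-isolated K (part u)) same-part ⟨
    clique-or-isolated K (part u) (part u)             ≡⟨ cliques-loop K (part u) (subst (ℕ._< K) (sym (toℕ-part u)) (large⇒code<K u lu)) ⟩
    true                                               ∎
    where
    open ≡-Reasoning
    same-class : Same u v ≡ true
    same-class = adj⇒Same u v uv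
    lv : large v ≡ true
    lv = trans (sym (large-cong u v same-class)) lu
    same-code : code u ≡ code v
    same-code = trans (code-large u lu) (trans (cong rank (rep-cong u v same-class)) (sym (code-large v lv)))
    same-part : part u ≡ part v
    same-part = FinP.toℕ-injective (trans (toℕ-part u) (trans same-code (sym (toℕ-part v))))

  large-no-mismatch : ∀ u → large u ≡ true → mismatches G H u ≡ 0
  large-no-mismatch u lu = trans
    (sum-cong-≗ {n} (λ v → cong ind (trans (cong (_xor adj H u v) (agree v)) (xor-same (adj H u v)))))
    (trans (sum-const n 0) (ℕP.*-zeroʳ n))
    where
    agree : ∀ v → adj G u v ≡ adj H u v
    agree v with adj G u v in uv
    ... | true  = sym (H-keeps-large u v lu uv)
    ... | false = sym (H-no-new-edges u v uv)

  -- ... and one of a small class mismatches only inside its class, of size at most n/K.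
  small-few-mismatches : ∀ u → large u ≡ false → K ℕ.* mismatches G H u ℕ.≤ n
  small-few-mismatches u su = ℕP.≤-trans (ℕP.*-monoʳ-≤ K (sum-mono {n} inside-class)) small
    where
    inside-class : ∀ v → ind (adj G u v xor adj H u v) ℕ.≤ ind (Same u v)
    inside-class v with adj G u v in uv
    ... | true  = ℕP.≤-trans (ind≤1 _) (ℕP.≤-reflexive (cong ind (sym (∨-zeroʳ (does (u Fin.≟ v))))))
    ... | false rewrite H-no-new-edges u v uv = z≤n
    small : K ℕ.* classSize u ℕ.≤ n
    small = ℕP.≮⇒≥ (λ n<Ks → true≢false (trans (sym (<⇒<ᵇ≡true n<Ks)) su))

  few-mismatches : ∀ u → K ℕ.* mismatches G H u ℕ.≤ n
  few-mismatches u = by-size (large u) refl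
    where
    by-size : ∀ b → large u ≡ b → K ℕ.* mismatches G H u ℕ.≤ n
    by-size true  lu = ℕP.≤-trans (ℕP.≤-reflexive (trans (cong (K ℕ.*_) (large-no-mismatch u lu)) (ℕP.*-zeroʳ K))) z≤n
    by-size false su = small-few-mismatches u su

  rounding-cost : K ℕ.* diffCount G H ℕ.≤ n ℕ.* n
  rounding-cost = edit-bound G H K few-mismatches

P3-free-near-cliques : ∀ ε t → 0ℚ ≤ ε → 1ℚ ≤ ℕtoℚ t * ε →
  ∀ n (G : Graph n) → InducedP3Free n G → DistToPropWithinHalf ε G P[ cliques (2 ℕ.* t) ]
P3-free-near-cliques ε t ε≥0 tε≥1 n G p3-free =
  H , realise-obeys (cliques (2 ℕ.* t)) part , count-within-half ε t (diffCount G H) n ε≥0 tε≥1 rounding-cost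
  where open Rounding G p3-free (2 ℕ.* t)

cliques-near-P3-free : ∀ ε K → 0ℚ ≤ ε →
  ∀ n (H : Graph n) → P[ cliques K ] n H → DistToPropWithinHalf ε H InducedP3Free
cliques-near-P3-free ε K ε≥0 n H obeys =
  H , diagonal-obeys⇒P3-free (cliques K) (λ i j e → proj₁ (cliques-edge K i j e)) H obeys , no-edits
  where
  no-edits : DistWithinHalf ε H H
  no-edits rewrite diffCount-self H = nothing-within-half ε (n ℕ.* n) ε≥0

lemma4p1 : ∃ λ (C : ℕ) → ∀ (ε : ℚ) → 0ℚ < ε →
    ∃ λ (k : ℕ) → (ℕtoℚ k * ε ≤ ℕtoℚ C * (ε + 1ℚ)) ×
    ∃ λ (F : List GraphProperty) →
    All (InHPP k) F × IsEpsCover ε F InducedP3Free × length F ≡ 1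
lemma4p1 = 3 , cover
  where
  cover : ∀ ε → 0ℚ < ε → ∃ λ k → (ℕtoℚ k * ε ≤ ℕtoℚ 3 * (ε + 1ℚ)) ×
    ∃ λ (F : List GraphProperty) → All (InHPP k) F × IsEpsCover ε F InducedP3Free × length F ≡ 1
  cover ε ε>0 with scale-for ε ε>0
  ... | t , tε≥1 , tε≤1+ε =
    suc K , parts-bound ε t ε≥0 tε≤1+ε ,
    P[ cliques K ] ∷ [] , partition-in-HPP (cliques K) (s≤s z≤n) ∷ [] ,
    ((λ n G p3-free → here (P3-free-near-cliques ε t ε≥0 tε≥1 n G p3-free)) ,
     cliques-near-P3-free ε K ε≥0 ∷ []) ,
    refl
    where
    K : ℕ
    K = 2 ℕ.* t
    ε≥0 : 0ℚ ≤ ε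
    ε≥0 = ℚP.<⇒≤ ε>0
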